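{- Let $p$ be a prime, $q=p^e$, $a\in\mathbb{F}_q^*$, and $f(x)=(x-a)^k\in\mathbb{F}_q[x]$ with $k\geq1$. Then every $f$-subgroup $M$ (in any extension field of $\mathbb{F}_q$) is of the form $M=\langle a\rangle$ and is standard as an $f$-subgroup.
   Context: A sequence $s=\{s_n\}_{n\in\mathbb{Z}}$ over a field is an $f$-sequence, for monic $f(x)=x^k-c_{k-1}x^{k-1}-\cdots-c_0$ with $c_0\neq0$, if $s_n=c_{k-1}s_{n-1}+\cdots+c_0s_{n-k}$ for all $n\in\mathbb{Z}$. A finite multiplicative subgroup $M$ of a field extending $\mathbb{F}_q$ is presented by a sequence $s$ if $s$ is periodic with (least) period $|M|$ and $M=\{s_0,\ldots,s_{|M|-1}\}$; $M$ is an $f$-subgroup if it is presented by some $f$-sequence. A sequence $s$ is cyclic if there is $\alpha$ with $s_{n+1}/s_n=\alpha$ for all $n$. An $f$-subgroup is non-standard if it can be presented by a non-cyclic $f$-sequence, and standard otherwise (i.e. every $f$-sequence presenting it is cyclic, $s_n=s_0\alpha^n$ with $\alpha$ a zero of $f$). $\langle a\rangle$ denotes the multiplicative group generated by $a$. -}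

module Defs where

open import Level using (Level; _⊔_)
open import Algebra.Bundles using (CommutativeRing)
open import Data.Nat using (ℕ; zero; suc; _<_; _≤_)
open import Data.Nat.Primality using (Prime)
open import Data.Fin using (Fin; toℕ)
open import Data.Integer as ℤ using (ℤ; +_)
open import Data.List using (List; []; _∷_; map)
open import Data.Product using (Σ; ∃; _×_; _,_)
open import Data.Sum using (_⊎_)
open import Function.Bundles using (_⇔_)
open import Relation.Nullary using (¬_)
open import Relation.Binary.PropositionalEquality using () renaming (_≡_ to _≡F_)

record IsField {c ℓ : Level} (K : CommutativeRing c ℓ) : Set (c ⊔ ℓ) where
  open CommutativeRing K
  field
    0≉1     : ¬ (0# ≈ 1#)
    inverse : ∀ x → ¬ (x ≈ 0#) → ∃ λ y → x * y ≈ 1#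

module FieldNotions {c ℓ : Level} (K : CommutativeRing c ℓ) where
  open CommutativeRing K

  pow : Carrier → ℕ → Carrier
  pow x zero    = 1#
  pow x (suc n) = x * pow x n

  sumTo : ℕ → (ℕ → Carrier) → Carrier
  sumTo zero    g = 0#
  sumTo (suc n) g = sumTo n g + g n

  -- polynomials over K as coefficient lists (constant term first)
  Poly : Set c
  Poly = List Carrier

  addP : Poly → Poly → Poly
  addP []       q        = q
  addP (x ∷ p)  []       = x ∷ p
  addP (x ∷ p)  (y ∷ q)  = (x + y) ∷ addP p q

  mulP : Poly → Poly → Poly
  mulP []      q = []
  mulP (x ∷ p) q = addP (map (x *_) q) (0# ∷ mulP p q)

  powP : Poly → ℕ → Poly
  powP f zero    = 1# ∷ []
  powP f (suc n) = mulP f (powP f n)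

  coeff : Poly → ℕ → Carrier
  coeff []      i       = 0#
  coeff (x ∷ p) zero    = x
  coeff (x ∷ p) (suc i) = coeff p i

  linPow : Carrier → ℕ → Poly
  linPow a k = powP (- a ∷ 1# ∷ []) k

  -- s is an f-sequence for the monic polynomial f of degree k,
  -- f(x) = x^k - c_{k-1} x^{k-1} - ... - c_0, i.e. c_i = - coeff f i:
  -- s_n = Σ_{i<k} c_i s_{n-k+i} for all n ∈ ℤ.
  IsFSeq : ℕ → Poly → (ℤ → Carrier) → Set ℓ
  IsFSeq k f s = ∀ (n : ℤ) →
    s n ≈ sumTo k (λ i → (- coeff f i) * s ((n ℤ.- + k) ℤ.+ + i))

  HasPeriod : (ℤ → Carrier) → ℕ → Set ℓ
  HasPeriod s m = ∀ (n : ℤ) → s (n ℤ.+ + m) ≈ s n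

  LeastPeriod : (ℤ → Carrier) → ℕ → Set ℓ
  LeastPeriod s N = 1 ≤ N × HasPeriod s N × (∀ m → 1 ≤ m → m < N → ¬ HasPeriod s m)

  record IsFiniteSubgroup {m : Level} (M : Carrier → Set m) (N : ℕ) : Set (c ⊔ ℓ ⊔ m) where
    field
      enum      : Fin N → Carrier
      enum-inj  : ∀ i j → enum i ≈ enum j → i ≡F j
      enum-in   : ∀ i → M (enum i)
      enum-onto : ∀ x → M x → ∃ λ i → x ≈ enum i
      respects  : ∀ x y → x ≈ y → M x → M y
      nonzero   : ∀ x → M x → ¬ (x ≈ 0#)
      one∈      : M 1#
      mul∈      : ∀ x y → M x → M y → M (x * y)
      inv∈      : ∀ x y → M x → x * y ≈ 1# → M y

  Presents : {m : Level} → (Carrier → Set m) → ℕ → (ℤ → Carrier) → Set (c ⊔ ℓ ⊔ m)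
  Presents M N s = LeastPeriod s N × (∀ x → M x ⇔ (Σ ℕ λ i → i < N × x ≈ s (+ i)))

  Cyclic : (ℤ → Carrier) → Set (c ⊔ ℓ)
  Cyclic s = ∃ λ α → ∀ (n : ℤ) → s (n ℤ.+ + 1) ≈ α * s n

  Generated : Carrier → Carrier → Set ℓ
  Generated a x = ∃ λ (n : ℕ) → (x ≈ pow a n) ⊎ (x * pow a n ≈ 1#)

  -- K contains a subfield with exactly q elements (a copy of F_q),
  -- listed injectively by elems; a subset closed under 0,1,+,-,* and
  -- inverses of nonzero elements.
  record FiniteSubfield (q : ℕ) : Set (c ⊔ ℓ) where
    field
      elems  : Fin q → Carrier
      inj    : ∀ i j → elems i ≈ elems j → i ≡F j
    InF : Carrier → Set ℓ
    InF x = ∃ λ i → x ≈ elems i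
    field
      zero∈  : InF 0#
      one∈   : InF 1#
      add∈   : ∀ x y → InF x → InF y → InF (x + y)
      neg∈   : ∀ x → InF x → InF (- x)
      mul∈   : ∀ x y → InF x → InF y → InF (x * y)
      inv∈   : ∀ x y → InF x → x * y ≈ 1# → InF y

module Submission where

open import Defs
open import Level using (Level)
open import Algebra.Bundles using (CommutativeRing)
open import Data.Nat using (ℕ; _≤_; _^_)
open import Data.Nat.Primality using (Prime)
open import Data.Integer using (ℤ)
open import Data.Product using (∃; _×_)
open import Function.Bundles using (_⇔_)
open import Relation.Nullary using (¬_)

open import Data.Nat as ℕ using (zero; suc; z≤n; s≤s; _<_)
import Data.Nat.Properties as ℕP
open import Data.Integer as ℤ using (+_)
import Data.Integer.Properties as ℤP
open import Data.Integer.Solver using (module +-*-Solver)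
open import Data.Fin as Fin using (Fin)
import Data.Fin.Properties as FinP
open import Data.Fin.Permutation using (Permutation; permutation; _⟨$⟩ʳ_)
open import Data.Vec.Functional using (head; tail)
open import Data.List using ([]; _∷_; length; map)
import Data.List.Properties as ListP
open import Data.Product using (_,_; proj₁; proj₂)
open import Data.Sum using (inj₁; inj₂)
open import Function using (_∘_)
open import Function.Bundles using (mk⇔; Equivalence)
open import Relation.Nullary using (Dec; yes; no)
open import Relation.Binary.PropositionalEquality as ≡ using (_≡_)
import Algebra.Solver.Ring.NaturalCoefficients.Default as NatSolver

-- Write E for the shift of ℤ-indexed sequences. An f-sequence for f = (x − a)^k is a
-- sequence annihilated by (E − a)^k. If u has period N and (E − a)² u = 0, then
-- v = (E − a) u is geometric, and u_{n+m} = a^m u_n + m a^(m−1) v_n. Periodicity of v gives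
-- (a^N − 1) v = 0, periodicity of u gives N a^N v = (1 − a^N) a u; so v = 0 provided N ≠ 0
-- in K. That holds because N is the order of a finite subgroup M of K^*: otherwise
-- y^i Σ_{g∈M} g^i = Σ_{g∈M} g^i for y ∈ M makes every power sum square to zero, hence vanish,
-- and then Σ_{g∈M} Q(g) = 0 for every polynomial Q; but Σ_{g∈M} Q(g) = Q(g₀) ≠ 0 for
-- Q = ∏_{g≠g₀} (x − g). Peeling off one factor x − a at a time,
-- a periodic f-sequence satisfies s_{n+1} = a s_n; its values s_0 a^n then form a group
-- containing 1 and a = s_1 / s_0, that is ⟨a⟩.

module FieldProperties {c ℓ} (K : CommutativeRing c ℓ) (isField : IsField K) where
  open CommutativeRing K
  open IsField isField
  open import Relation.Binary.Reasoning.Setoid setoid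

  *-cancelʳ-nonzero : ∀ {x y z} → ¬ (z ≈ 0#) → x * z ≈ y * z → x ≈ y
  *-cancelʳ-nonzero {x} {y} {z} z≉0 xz≈yz with inverse z z≉0
  ... | z⁻¹ , zz⁻¹≈1 = begin
    x              ≈⟨ *-identityʳ x ⟨
    x * 1#         ≈⟨ *-congˡ zz⁻¹≈1 ⟨
    x * (z * z⁻¹)  ≈⟨ *-assoc x z z⁻¹ ⟨
    x * z * z⁻¹    ≈⟨ *-congʳ xz≈yz ⟩
    y * z * z⁻¹    ≈⟨ *-assoc y z z⁻¹ ⟩
    y * (z * z⁻¹)  ≈⟨ *-congˡ zz⁻¹≈1 ⟩
    y * 1#         ≈⟨ *-identityʳ y ⟩
    y              ∎

  x*y≈0⇒y≈0 : ∀ {x y} → ¬ (x ≈ 0#) → x * y ≈ 0# → y ≈ 0#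
  x*y≈0⇒y≈0 {x} {y} x≉0 xy≈0 = *-cancelʳ-nonzero x≉0 (begin
    y * x   ≈⟨ *-comm y x ⟩
    x * y   ≈⟨ xy≈0 ⟩
    0#      ≈⟨ zeroˡ x ⟨
    0# * x  ∎)

  *-nonzero : ∀ {x y} → ¬ (x ≈ 0#) → ¬ (y ≈ 0#) → ¬ (x * y ≈ 0#)
  *-nonzero x≉0 y≉0 xy≈0 = y≉0 (x*y≈0⇒y≈0 x≉0 xy≈0)

  x*x≈0⇒¬¬x≈0 : ∀ {x} → x * x ≈ 0# → ¬ ¬ (x ≈ 0#)
  x*x≈0⇒¬¬x≈0 xx≈0 x≉0 = x≉0 (x*y≈0⇒y≈0 x≉0 xx≈0)

module PowerProperties {c ℓ} (K : CommutativeRing c ℓ) where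
  open CommutativeRing K
  open FieldNotions K
  open import Relation.Binary.Reasoning.Setoid setoid
  open NatSolver commutativeSemiring using (solve; _:*_; _:=_)

  pow-congˡ : ∀ {x y} n → x ≈ y → pow x n ≈ pow y n
  pow-congˡ zero    x≈y = refl
  pow-congˡ (suc n) x≈y = *-cong x≈y (pow-congˡ n x≈y)

  pow-+ : ∀ x m n → pow x (m ℕ.+ n) ≈ pow x m * pow x n
  pow-+ x zero    n = sym (*-identityˡ (pow x n))
  pow-+ x (suc m) n = trans (*-congˡ (pow-+ x m n)) (sym (*-assoc x (pow x m) (pow x n)))

  pow-distrib-* : ∀ x y n → pow (x * y) n ≈ pow x n * pow y n
  pow-distrib-* x y zero    = sym (*-identityʳ 1#)
  pow-distrib-* x y (suc n) = begin
    x * y * pow (x * y) n          ≈⟨ *-congˡ (pow-distrib-* x y n) ⟩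
    x * y * (pow x n * pow y n)    ≈⟨ solve 4 (λ x y p q → x :* y :* (p :* q) := x :* p :* (y :* q))
                                              refl x y (pow x n) (pow y n) ⟩
    x * pow x n * (y * pow y n)    ∎

module IntegerShift where
  open +-*-Solver using (solve; _:+_; _:-_; _:=_; con)

  n+[1+m]≡n+m+1 : ∀ (n : ℤ) m → n ℤ.+ + suc m ≡ (n ℤ.+ + m) ℤ.+ + 1
  n+[1+m]≡n+m+1 n m = solve 2 (λ n m → n :+ (con (+ 1) :+ m) := (n :+ m) :+ con (+ 1)) ≡.refl n (+ m)

  n+m+k≡n+k+m : ∀ (n : ℤ) m k → (n ℤ.+ + m) ℤ.+ + k ≡ (n ℤ.+ + k) ℤ.+ + m
  n+m+k≡n+k+m n m k = solve 3 (λ n m k → (n :+ m) :+ k := (n :+ k) :+ m) ≡.refl n (+ m) (+ k)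

  n+k-k+i≡n+i : ∀ (n : ℤ) k i → ((n ℤ.+ + k) ℤ.- + k) ℤ.+ + i ≡ n ℤ.+ + i
  n+k-k+i≡n+i n k i = solve 3 (λ n k i → ((n :+ k) :- k) :+ i := n :+ i) ≡.refl n (+ k) (+ i)

module PolynomialProperties {c ℓ} (K : CommutativeRing c ℓ) where
  open CommutativeRing K
  open FieldNotions K
  open import Relation.Binary.Reasoning.Setoid setoid

  length-addP : ∀ f g {L} → length f ≤ L → length g ≤ L → length (addP f g) ≤ L
  length-addP []      g       f≤L       g≤L       = g≤L
  length-addP (x ∷ f) []      f≤L       g≤L       = f≤L
  length-addP (x ∷ f) (y ∷ g) (s≤s f≤L) (s≤s g≤L) = s≤s (length-addP f g f≤L g≤L)

  length-scale : ∀ x f {L} → length f ≤ L → length (map (x *_) f) ≤ L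
  length-scale x f f≤L = ≡.subst (_≤ _) (≡.sym (ListP.length-map (x *_) f)) f≤L

  coeff-beyond : ∀ f {i} → length f ≤ i → coeff f i ≈ 0#
  coeff-beyond []      _         = refl
  coeff-beyond (x ∷ f) (s≤s f≤i) = coeff-beyond f f≤i

  coeff-addP : ∀ f g i → coeff (addP f g) i ≈ coeff f i + coeff g i
  coeff-addP []      g       i       = sym (+-identityˡ _)
  coeff-addP (x ∷ f) []      zero    = sym (+-identityʳ _)
  coeff-addP (x ∷ f) []      (suc i) = sym (+-identityʳ _)
  coeff-addP (x ∷ f) (y ∷ g) zero    = refl
  coeff-addP (x ∷ f) (y ∷ g) (suc i) = coeff-addP f g i

  coeff-scale : ∀ x f i → coeff (map (x *_) f) i ≈ x * coeff f i
  coeff-scale x []      i       = sym (zeroʳ x)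
  coeff-scale x (y ∷ f) zero    = refl
  coeff-scale x (y ∷ f) (suc i) = coeff-scale x f i

  coeff-zeroPoly : ∀ i → coeff (0# ∷ []) i ≈ 0#
  coeff-zeroPoly zero    = refl
  coeff-zeroPoly (suc i) = refl

  length-*-monicLinear : ∀ r f {L} → length f ≤ suc L → length (mulP (r ∷ 1# ∷ []) f) ≤ suc (suc L)
  length-*-monicLinear r f f≤L =
    length-addP (map (r *_) f) (0# ∷ addP (map (1# *_) f) (0# ∷ []))
      (length-scale r f (ℕP.m≤n⇒m≤1+n f≤L))
      (s≤s (length-addP (map (1# *_) f) (0# ∷ []) (length-scale 1# f f≤L) (s≤s z≤n)))

  coeff-*-monicLinear : ∀ r f {L} → length f ≤ suc L → coeff (mulP (r ∷ 1# ∷ []) f) (suc L) ≈ coeff f L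
  coeff-*-monicLinear r f {L} f≤1+L = begin
    coeff (addP (map (r *_) f) (0# ∷ addP (map (1# *_) f) (0# ∷ []))) (suc L)
      ≈⟨ coeff-addP (map (r *_) f) (0# ∷ addP (map (1# *_) f) (0# ∷ [])) (suc L) ⟩
    coeff (map (r *_) f) (suc L) + coeff (addP (map (1# *_) f) (0# ∷ [])) L
      ≈⟨ +-cong (trans (coeff-scale r f (suc L)) (trans (*-congˡ (coeff-beyond f f≤1+L)) (zeroʳ r)))
                (coeff-addP (map (1# *_) f) (0# ∷ []) L) ⟩
    0# + (coeff (map (1# *_) f) L + coeff (0# ∷ []) L)
      ≈⟨ +-identityˡ _ ⟩
    coeff (map (1# *_) f) L + coeff (0# ∷ []) L
      ≈⟨ +-cong (trans (coeff-scale 1# f L) (*-identityˡ _)) (coeff-zeroPoly L) ⟩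
    coeff f L + 0#
      ≈⟨ +-identityʳ _ ⟩
    coeff f L ∎

  length-linPow : ∀ a k → length (linPow a k) ≤ suc k
  length-linPow a zero    = s≤s z≤n
  length-linPow a (suc k) = length-*-monicLinear (- a) (linPow a k) (length-linPow a k)

  coeff-linPow : ∀ a k → coeff (linPow a k) k ≈ 1#
  coeff-linPow a zero    = refl
  coeff-linPow a (suc k) =
    trans (coeff-*-monicLinear (- a) (linPow a k) (length-linPow a k)) (coeff-linPow a k)

module ShiftOperator {c ℓ} (K : CommutativeRing c ℓ) where
  open CommutativeRing K
  open FieldNotions K
  open IntegerShift
  open import Algebra.Properties.Ring ring using (-‿distribˡ-*; -‿+-comm; -0#≈0#)
  open import Relation.Binary.Reasoning.Setoid setoid
  open NatSolver commutativeSemiring using (solve; _:+_; _:*_; _:=_)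

  Seq : Set c
  Seq = ℤ → Carrier

  -- act f s = f(E) s, where E is the shift (E s)_n = s_{n+1}.
  act : Poly → Seq → Seq
  act []      s n = 0#
  act (x ∷ f) s n = x * s n + act f s (n ℤ.+ + 1)

  act-cong : ∀ f {s t : Seq} → (∀ n → s n ≈ t n) → ∀ n → act f s n ≈ act f t n
  act-cong []      s≈t n = refl
  act-cong (x ∷ f) s≈t n = +-cong (*-congˡ (s≈t n)) (act-cong f s≈t _)

  act-addP : ∀ f g (s : Seq) n → act (addP f g) s n ≈ act f s n + act g s n
  act-addP []      g       s n = sym (+-identityˡ _)
  act-addP (x ∷ f) []      s n = sym (+-identityʳ _)
  act-addP (x ∷ f) (y ∷ g) s n = begin
    (x + y) * s n + act (addP f g) s n′              ≈⟨ +-cong (distribʳ (s n) x y) (act-addP f g s n′) ⟩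
    x * s n + y * s n + (act f s n′ + act g s n′)
      ≈⟨ solve 4 (λ a b c d → a :+ b :+ (c :+ d) := a :+ c :+ (b :+ d)) refl (x * s n) (y * s n) _ _ ⟩
    x * s n + act f s n′ + (y * s n + act g s n′)    ∎
    where n′ = n ℤ.+ + 1

  act-scale : ∀ x f (s : Seq) n → act (map (x *_) f) s n ≈ x * act f s n
  act-scale x []      s n = sym (zeroʳ x)
  act-scale x (y ∷ f) s n = trans (+-cong (*-assoc x y (s n)) (act-scale x f s _)) (sym (distribˡ x _ _))

  act-mulP : ∀ f g (s : Seq) n → act (mulP f g) s n ≈ act f (act g s) n
  act-mulP []      g s n = refl
  act-mulP (x ∷ f) g s n = begin
    act (addP (map (x *_) g) (0# ∷ mulP f g)) s n          ≈⟨ act-addP (map (x *_) g) (0# ∷ mulP f g) s n ⟩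
    act (map (x *_) g) s n + (0# * s n + act (mulP f g) s n′)
      ≈⟨ +-cong (act-scale x g s n) (trans (+-congʳ (zeroˡ (s n))) (+-identityˡ _)) ⟩
    x * act g s n + act (mulP f g) s n′                     ≈⟨ +-congˡ (act-mulP f g s n′) ⟩
    x * act g s n + act f (act g s) n′                      ∎
    where n′ = n ℤ.+ + 1

  act-periodic : ∀ f {s N} → HasPeriod s N → HasPeriod (act f s) N
  act-periodic []      s-periodic n = refl
  act-periodic (x ∷ f) {s} {N} s-periodic n = +-cong (*-congˡ (s-periodic n))
    (trans (reflexive (≡.cong (act f s) (n+m+k≡n+k+m n N 1))) (act-periodic f s-periodic (n ℤ.+ + 1)))

  sumTo-cong : ∀ L {g h : ℕ → Carrier} → (∀ i → g i ≈ h i) → sumTo L g ≈ sumTo L h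
  sumTo-cong zero    g≈h = refl
  sumTo-cong (suc L) g≈h = +-cong (sumTo-cong L g≈h) (g≈h L)

  sumTo-zero : ∀ L → sumTo L (λ _ → 0#) ≈ 0#
  sumTo-zero zero    = refl
  sumTo-zero (suc L) = trans (+-identityʳ _) (sumTo-zero L)

  sumTo-suc-head : ∀ L (g : ℕ → Carrier) → sumTo (suc L) g ≈ g 0 + sumTo L (g ∘ suc)
  sumTo-suc-head zero    g = trans (+-identityˡ _) (sym (+-identityʳ _))
  sumTo-suc-head (suc L) g = trans (+-congʳ (sumTo-suc-head L g)) (+-assoc _ _ _)

  sumTo-neg : ∀ L (g : ℕ → Carrier) → sumTo L (λ i → - g i) ≈ - sumTo L g
  sumTo-neg zero    g = sym -0#≈0#
  sumTo-neg (suc L) g = trans (+-congʳ (sumTo-neg L g)) (-‿+-comm _ _)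

  act≈sumTo : ∀ f (s : Seq) {L} → length f ≤ L → ∀ n → act f s n ≈ sumTo L (λ i → coeff f i * s (n ℤ.+ + i))
  act≈sumTo []      s {L}     _            n = sym (trans (sumTo-cong L (λ i → zeroˡ _)) (sumTo-zero L))
  act≈sumTo (x ∷ f) s {suc L} (s≤s len≤L) n = begin
    x * s n + act f s (n ℤ.+ + 1)
      ≈⟨ +-cong (*-congˡ (reflexive (≡.cong s (≡.sym (ℤP.+-identityʳ n))))) (act≈sumTo f s len≤L (n ℤ.+ + 1)) ⟩
    x * s (n ℤ.+ + 0) + sumTo L (λ i → coeff f i * s ((n ℤ.+ + 1) ℤ.+ + i))
      ≈⟨ +-congˡ (sumTo-cong L (λ i → *-congˡ (reflexive (≡.cong s (ℤP.+-assoc n (+ 1) (+ i)))))) ⟩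
    x * s (n ℤ.+ + 0) + sumTo L (λ i → coeff f i * s (n ℤ.+ + suc i))
      ≈⟨ sumTo-suc-head L (λ i → coeff (x ∷ f) i * s (n ℤ.+ + i)) ⟨
    sumTo (suc L) (λ i → coeff (x ∷ f) i * s (n ℤ.+ + i)) ∎

  IsFSeq⇒annihilated : ∀ {k} f (s : Seq) → length f ≤ suc k → coeff f k ≈ 1# → IsFSeq k f s →
                       ∀ n → act f s n ≈ 0#
  IsFSeq⇒annihilated {k} f s len≤ monic recurrence n = begin
    act f s n                                     ≈⟨ act≈sumTo f s len≤ n ⟩
    sumTo k t + coeff f k * s (n ℤ.+ + k)         ≈⟨ +-congˡ (trans (*-congʳ monic) (*-identityˡ _)) ⟩
    sumTo k t + s (n ℤ.+ + k)                     ≈⟨ +-congˡ (recurrence (n ℤ.+ + k)) ⟩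
    sumTo k t + sumTo k (λ i → (- coeff f i) * s (((n ℤ.+ + k) ℤ.- + k) ℤ.+ + i))
      ≈⟨ +-congˡ (sumTo-cong k (λ i → trans (*-congˡ (reflexive (≡.cong s (n+k-k+i≡n+i n k i))))
                                              (sym (-‿distribˡ-* _ _)))) ⟩
    sumTo k t + sumTo k (λ i → - t i)             ≈⟨ +-congˡ (sumTo-neg k t) ⟩
    sumTo k t - sumTo k t                         ≈⟨ -‿inverseʳ _ ⟩
    0#                                            ∎
    where
    t : ℕ → Carrier
    t i = coeff f i * s (n ℤ.+ + i)

  geometric : ∀ {a} {t : Seq} → (∀ n → t (n ℤ.+ + 1) ≈ a * t n) → ∀ n m → t (n ℤ.+ + m) ≈ pow a m * t n
  geometric {a} {t} step n zero = trans (reflexive (≡.cong t (ℤP.+-identityʳ n))) (sym (*-identityˡ _))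
  geometric {a} {t} step n (suc m) = begin
    t (n ℤ.+ + suc m)          ≡⟨ ≡.cong t (n+[1+m]≡n+m+1 n m) ⟩
    t ((n ℤ.+ + m) ℤ.+ + 1)    ≈⟨ step _ ⟩
    a * t (n ℤ.+ + m)          ≈⟨ *-congˡ (geometric step n m) ⟩
    a * (pow a m * t n)        ≈⟨ *-assoc _ _ _ ⟨
    pow a (suc m) * t n        ∎

module FiniteSubgroupOrder {c ℓ} (K : CommutativeRing c ℓ) (isField : IsField K) where
  open CommutativeRing K
  open FieldNotions K
  open IsField isField
  open FieldProperties K isField
  open PowerProperties K
  open import Algebra.Properties.Ring ring using (x∙y⁻¹≈ε⇒x≈y)
  open import Algebra.Properties.Semiring.Sum semiring
    using (sum; sum-cong-≋; sum-replicate; sum-replicate-zero; sum-permute;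
           *-distribˡ-sum; *-distribʳ-sum; ∑-distrib-+)
  open import Algebra.Properties.Semiring.Mult semiring using (×-assoc-*; ×-congʳ) renaming (_×_ to _·_)
  open import Relation.Binary.Reasoning.Setoid setoid
  open NatSolver commutativeSemiring using (solve; _:+_; _:*_; _:=_)

  powerSum : ∀ {n} → (Fin n → Carrier) → ℕ → Carrier
  powerSum g k = sum (λ j → pow (g j) k)

  moment : ∀ {n} → (Fin n → Carrier) → (Carrier → Carrier) → ℕ → Carrier
  moment g Q k = sum (λ j → pow (g j) k * Q (g j))

  vanishingPoly : ∀ {n} → (Fin n → Carrier) → Carrier → Carrier
  vanishingPoly {zero}  rs x = 1#
  vanishingPoly {suc n} rs x = (x - head rs) * vanishingPoly (tail rs) x

  vanishingPoly-root : ∀ {n} (rs : Fin n → Carrier) j → vanishingPoly rs (rs j) ≈ 0#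
  vanishingPoly-root rs Fin.zero    = trans (*-congʳ (-‿inverseʳ (head rs))) (zeroˡ _)
  vanishingPoly-root rs (Fin.suc j) = trans (*-congˡ (vanishingPoly-root (tail rs) j)) (zeroʳ _)

  vanishingPoly-nonroot : ∀ {n} (rs : Fin n → Carrier) {x} → (∀ j → ¬ (x ≈ rs j)) →
                          ¬ (vanishingPoly rs x ≈ 0#)
  vanishingPoly-nonroot {zero}  rs x≉rs 1≈0 = 0≉1 (sym 1≈0)
  vanishingPoly-nonroot {suc n} rs x≉rs =
    *-nonzero (x≉rs Fin.zero ∘ x∙y⁻¹≈ε⇒x≈y _ _) (vanishingPoly-nonroot (tail rs) (x≉rs ∘ Fin.suc))

  moment-*-linear : ∀ {n} (g : Fin n → Carrier) Q r k →
                    moment g (λ x → (x - r) * Q x) k ≈ moment g Q (suc k) + (- r) * moment g Q k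
  moment-*-linear {n} g Q r k = begin
    sum {n} (λ j → pow (g j) k * ((g j - r) * Q (g j)))
      ≈⟨ sum-cong-≋ (λ j → solve 4 (λ x p r′ q → p :* ((x :+ r′) :* q) := x :* p :* q :+ r′ :* (p :* q))
                                    refl (g j) (pow (g j) k) (- r) (Q (g j))) ⟩
    sum {n} (λ j → pow (g j) (suc k) * Q (g j) + (- r) * (pow (g j) k * Q (g j)))
      ≈⟨ ∑-distrib-+ (λ j → pow (g j) (suc k) * Q (g j)) (λ j → (- r) * (pow (g j) k * Q (g j))) ⟩
    moment g Q (suc k) + sum {n} (λ j → (- r) * (pow (g j) k * Q (g j)))
      ≈⟨ +-congˡ (*-distribˡ-sum (- r) (λ j → pow (g j) k * Q (g j))) ⟨
    moment g Q (suc k) + (- r) * moment g Q k ∎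

  module _ {n} (g : Fin n → Carrier) (powerSums≈0 : ∀ k → ¬ ¬ (powerSum g k ≈ 0#)) where

    MomentsVanish : (Carrier → Carrier) → Set ℓ
    MomentsVanish Q = ∀ k → ¬ ¬ (moment g Q k ≈ 0#)

    momentsVanish-vanishingPoly : ∀ {m} (rs : Fin m → Carrier) → MomentsVanish (vanishingPoly rs)
    momentsVanish-vanishingPoly {zero} rs k moment≉0 =
      powerSums≈0 k (moment≉0 ∘ trans (sum-cong-≋ (λ j → *-identityʳ (pow (g j) k))))
    momentsVanish-vanishingPoly {suc m} rs k moment≉0 =
      IH (suc k) λ higher≈0 → IH k λ lower≈0 → moment≉0 (begin
        moment g (λ x → (x - head rs) * Q x) k           ≈⟨ moment-*-linear g Q (head rs) k ⟩
        moment g Q (suc k) + (- head rs) * moment g Q k  ≈⟨ +-cong higher≈0 (*-congˡ lower≈0) ⟩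
        0# + (- head rs) * 0#                            ≈⟨ +-identityˡ _ ⟩
        (- head rs) * 0#                                 ≈⟨ zeroʳ _ ⟩
        0#                                               ∎)
      where
      Q = vanishingPoly (tail rs)
      IH = momentsVanish-vanishingPoly (tail rs)

  powerSums-cannotVanish : ∀ {n} (g : Fin (suc n) → Carrier) → (∀ i j → g i ≈ g j → i ≡ j) →
                           ¬ (∀ k → ¬ ¬ (powerSum g k ≈ 0#))
  powerSums-cannotVanish {n} g g-injective powerSums≈0 =
    momentsVanish-vanishingPoly g powerSums≈0 (tail g) 0 (Q[g₀]≉0 ∘ trans (sym moment≈Q[g₀]))
    where
    Q = vanishingPoly (tail g)
    Q[g₀]≉0 : ¬ (Q (head g) ≈ 0#)
    Q[g₀]≉0 = vanishingPoly-nonroot (tail g) (λ j → FinP.0≢1+n ∘ g-injective Fin.zero (Fin.suc j))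
    moment≈Q[g₀] : moment g Q 0 ≈ Q (head g)
    moment≈Q[g₀] = begin
      1# * Q (head g) + sum {n} (λ j → 1# * Q (tail g j))
        ≈⟨ +-cong (*-identityˡ _) (sum-cong-≋ (λ j → trans (*-identityˡ _) (vanishingPoly-root (tail g) j))) ⟩
      Q (head g) + sum {n} (λ _ → 0#)  ≈⟨ +-congˡ (sum-replicate-zero n) ⟩
      Q (head g) + 0#                  ≈⟨ +-identityʳ _ ⟩
      Q (head g)                       ∎

  module _ {m} {M : Carrier → Set m} {N} (G : IsFiniteSubgroup M N) where
    open IsFiniteSubgroup G

    indexOf : ∀ {x} → M x → Fin N
    indexOf {x} x∈M = proj₁ (enum-onto x x∈M)

    enum-indexOf : ∀ {x} (x∈M : M x) → enum (indexOf x∈M) ≈ x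
    enum-indexOf {x} x∈M = sym (proj₂ (enum-onto x x∈M))

    private
      mulBy : ∀ {y} → M y → Fin N → Fin N
      mulBy {y} y∈M j = indexOf (mul∈ y (enum j) y∈M (enum-in j))

      mulBy-inverse : ∀ {y z} (y∈M : M y) (z∈M : M z) → y * z ≈ 1# → ∀ j → mulBy y∈M (mulBy z∈M j) ≡ j
      mulBy-inverse {y} {z} y∈M z∈M yz≈1 j = enum-inj _ _ (begin
        enum (mulBy y∈M (mulBy z∈M j))  ≈⟨ enum-indexOf _ ⟩
        y * enum (mulBy z∈M j)          ≈⟨ *-congˡ (enum-indexOf _) ⟩
        y * (z * enum j)                ≈⟨ *-assoc y z (enum j) ⟨
        y * z * enum j                  ≈⟨ *-congʳ yz≈1 ⟩
        1# * enum j                     ≈⟨ *-identityˡ (enum j) ⟩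
        enum j                          ∎)

    translation : ∀ {y} → M y → Permutation N N
    translation {y} y∈M with inverse y (nonzero y y∈M)
    ... | y⁻¹ , yy⁻¹≈1 = permutation (mulBy y∈M) (mulBy y⁻¹∈M)
      (mulBy-inverse y∈M y⁻¹∈M yy⁻¹≈1) (mulBy-inverse y⁻¹∈M y∈M (trans (*-comm y⁻¹ y) yy⁻¹≈1))
      where y⁻¹∈M = inv∈ y y⁻¹ y∈M yy⁻¹≈1

    enum-translation : ∀ {y} (y∈M : M y) j → enum (translation y∈M ⟨$⟩ʳ j) ≈ y * enum j
    enum-translation {y} y∈M j with inverse y (nonzero y y∈M)
    ... | _ = enum-indexOf _

    powerSum-translationInvariant : ∀ {y} → M y → ∀ k → pow y k * powerSum enum k ≈ powerSum enum k
    powerSum-translationInvariant {y} y∈M k = begin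
      pow y k * powerSum enum k                   ≈⟨ *-distribˡ-sum (pow y k) (λ j → pow (enum j) k) ⟩
      sum {N} (λ j → pow y k * pow (enum j) k)    ≈⟨ sum-cong-≋ (λ j → pow-distrib-* y (enum j) k) ⟨
      sum {N} (λ j → pow (y * enum j) k)          ≈⟨ sum-cong-≋ (λ j → pow-congˡ k (enum-translation y∈M j)) ⟨
      sum {N} (λ j → pow (enum (π ⟨$⟩ʳ j)) k)     ≈⟨ sum-permute (λ j → pow (enum j) k) π ⟨
      powerSum enum k                             ∎
      where π = translation y∈M

    powerSum-squared : ∀ k → powerSum enum k * powerSum enum k ≈ (N · 1#) * powerSum enum k
    powerSum-squared k = begin
      S * S                               ≈⟨ *-distribʳ-sum S (λ j → pow (enum j) k) ⟩
      sum {N} (λ j → pow (enum j) k * S)  ≈⟨ sum-cong-≋ (λ j → powerSum-translationInvariant (enum-in j) k) ⟩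
      sum {N} (λ _ → S)                   ≈⟨ sum-replicate N ⟩
      N · S                               ≈⟨ ×-congʳ N (*-identityˡ S) ⟨
      N · (1# * S)                        ≈⟨ ×-assoc-* N 1# S ⟨
      (N · 1#) * S                        ∎
      where S = powerSum enum k

  order≉0 : ∀ {m} {M : Carrier → Set m} {N} → IsFiniteSubgroup M N → ¬ (N · 1# ≈ 0#)
  order≉0 {N = zero}  G _   with indexOf G (IsFiniteSubgroup.one∈ G)
  ... | ()
  order≉0 {N = suc n} G N≈0 = powerSums-cannotVanish enum enum-inj λ k →
    x*x≈0⇒¬¬x≈0 (trans (powerSum-squared G k) (trans (*-congʳ N≈0) (zeroˡ _)))
    where open IsFiniteSubgroup G

module LinearRecurrence {c ℓ} (K : CommutativeRing c ℓ) (isField : IsField K) where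
  open CommutativeRing K
  open FieldNotions K
  open FieldProperties K isField
  open IntegerShift using (n+[1+m]≡n+m+1)
  open ShiftOperator K
  open import Algebra.Properties.Ring ring
    using (-‿distribˡ-*; +-identityʳ-unique; [y-z]x≈yx-zx; x≈y⇒x∙y⁻¹≈ε; x∙y⁻¹≈ε⇒x≈y)
  open import Algebra.Properties.Semiring.Mult semiring using () renaming (_×_ to _·_)
  open import Relation.Binary.Reasoning.Setoid setoid
  open NatSolver commutativeSemiring using (solve; _:+_; _:*_; _:=_; con)

  module _ (a : Carrier) where

    Δ : Seq → Seq
    Δ = act (- a ∷ 1# ∷ [])

    act-linPow-suc : ∀ j (t : Seq) n → act (linPow a (suc j)) t n ≈ Δ (act (linPow a j) t) n
    act-linPow-suc j t n = act-mulP (- a ∷ 1# ∷ []) (linPow a j) t n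

    shift≈Δ+a* : ∀ (t : Seq) n → t (n ℤ.+ + 1) ≈ Δ t n + a * t n
    shift≈Δ+a* t n = begin
      t′                                   ≈⟨ +-identityʳ t′ ⟨
      t′ + 0#                              ≈⟨ +-congˡ (-‿inverseˡ (a * t n)) ⟨
      t′ + (- (a * t n) + a * t n)         ≈⟨ +-assoc t′ _ _ ⟨
      t′ + - (a * t n) + a * t n           ≈⟨ +-congʳ (+-comm t′ _) ⟩
      - (a * t n) + t′ + a * t n           ≈⟨ +-congʳ (+-cong (-‿distribˡ-* a (t n))
                                                   (sym (trans (+-identityʳ _) (*-identityˡ t′)))) ⟩
      - a * t n + (1# * t′ + 0#) + a * t n ∎
      where t′ = t (n ℤ.+ + 1)

    Δ≈0⇒geometricStep : ∀ {t : Seq} → (∀ n → Δ t n ≈ 0#) → ∀ n → t (n ℤ.+ + 1) ≈ a * t n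
    Δ≈0⇒geometricStep {t} Δt≈0 n = trans (shift≈Δ+a* t n) (trans (+-congʳ (Δt≈0 n)) (+-identityˡ _))

    -- The discrete analogue of (α + β n) aⁿ solving a double-root recurrence.
    Δ²≈0⇒shift : ∀ {u : Seq} → (∀ n → Δ (Δ u) n ≈ 0#) →
                 ∀ n m → a * u (n ℤ.+ + m) ≈ a * pow a m * u n + (m · 1#) * (pow a m * Δ u n)
    Δ²≈0⇒shift {u} Δ²u≈0 n zero = begin
      a * u (n ℤ.+ + 0)                      ≈⟨ *-congˡ (reflexive (≡.cong u (ℤP.+-identityʳ n))) ⟩
      a * u n                                ≈⟨ solve 3 (λ a U V → a :* U := a :* con 1 :* U :+ con 0 :* V)
                                                  refl a (u n) (1# * Δ u n) ⟩
      a * 1# * u n + 0# * (1# * Δ u n)       ∎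
    Δ²≈0⇒shift {u} Δ²u≈0 n (suc m) = begin
      a * u (n ℤ.+ + suc m)                              ≡⟨ ≡.cong (λ i → a * u i) (n+[1+m]≡n+m+1 n m) ⟩
      a * u ((n ℤ.+ + m) ℤ.+ + 1)                        ≈⟨ *-congˡ (shift≈Δ+a* u _) ⟩
      a * (Δ u (n ℤ.+ + m) + a * u (n ℤ.+ + m))
        ≈⟨ *-congˡ (+-cong (geometric (Δ≈0⇒geometricStep Δ²u≈0) n m) (Δ²≈0⇒shift Δ²u≈0 n m)) ⟩
      a * (P * V + (a * P * U + (m · 1#) * (P * V)))
        ≈⟨ solve 5 (λ a P U V m → a :* (P :* V :+ (a :* P :* U :+ m :* (P :* V)))
                                 := a :* (a :* P) :* U :+ (con 1 :+ m) :* (a :* P :* V)) refl a P U V (m · 1#) ⟩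
      a * (a * P) * U + (1# + m · 1#) * (a * P * V)       ∎
      where P = pow a m
            U = u n
            V = Δ u n

    periodic-Δ²≈0⇒Δ≈0 : ∀ {N} → ¬ (N · 1# ≈ 0#) → Dec (pow a N ≈ 1#) →
                        ∀ {u} → HasPeriod u N → (∀ n → Δ (Δ u) n ≈ 0#) → ∀ n → Δ u n ≈ 0#
    periodic-Δ²≈0⇒Δ≈0 {N} N≉0 (yes aᴺ≈1) {u} u-periodic Δ²u≈0 n =
      x*y≈0⇒y≈0 N≉0 (+-identityʳ-unique (a * u n) _ (begin
        a * u n + (N · 1#) * Δ u n                        ≈⟨ +-cong (*-congʳ (*-identityʳ a))
                                                               (*-congˡ (*-identityˡ _)) ⟨
        a * 1# * u n + (N · 1#) * (1# * Δ u n)            ≈⟨ +-cong (*-congʳ (*-congˡ aᴺ≈1)) (*-congˡ (*-congʳ aᴺ≈1)) ⟨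
        a * pow a N * u n + (N · 1#) * (pow a N * Δ u n)  ≈⟨ Δ²≈0⇒shift Δ²u≈0 n N ⟨
        a * u (n ℤ.+ + N)                                 ≈⟨ *-congˡ (u-periodic n) ⟩
        a * u n                                           ∎))
    periodic-Δ²≈0⇒Δ≈0 {N} N≉0 (no aᴺ≉1) {u} u-periodic Δ²u≈0 n =
      x*y≈0⇒y≈0 (aᴺ≉1 ∘ x∙y⁻¹≈ε⇒x≈y _ _) (trans ([y-z]x≈yx-zx (Δ u n) (pow a N) 1#) (x≈y⇒x∙y⁻¹≈ε (begin
        pow a N * Δ u n     ≈⟨ geometric (Δ≈0⇒geometricStep Δ²u≈0) n N ⟨
        Δ u (n ℤ.+ + N)     ≈⟨ act-periodic (- a ∷ 1# ∷ []) u-periodic n ⟩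
        Δ u n               ≈⟨ *-identityˡ (Δ u n) ⟨
        1# * Δ u n          ∎)))

    periodic-annihilated⇒Δ≈0 : ∀ {N} → ¬ (N · 1# ≈ 0#) → Dec (pow a N ≈ 1#) →
                               ∀ j {t} → HasPeriod t N → (∀ n → act (linPow a (suc j)) t n ≈ 0#) →
                               ∀ n → Δ t n ≈ 0#
    periodic-annihilated⇒Δ≈0 N≉0 aᴺ≟1 zero {t} _ annihilated n = begin
      Δ t n                        ≈⟨ act-cong (- a ∷ 1# ∷ []) (λ i → trans (+-identityʳ _) (*-identityˡ (t i))) n ⟨
      Δ (act (linPow a 0) t) n     ≈⟨ act-linPow-suc 0 t n ⟨
      act (linPow a 1) t n         ≈⟨ annihilated n ⟩
      0#                           ∎
    periodic-annihilated⇒Δ≈0 N≉0 aᴺ≟1 (suc j) {t} t-periodic annihilated =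
      periodic-annihilated⇒Δ≈0 N≉0 aᴺ≟1 j t-periodic λ n →
        trans (act-linPow-suc j t n)
              (periodic-Δ²≈0⇒Δ≈0 N≉0 aᴺ≟1 (act-periodic (linPow a j) t-periodic) Δ²u≈0 n)
      where
      Δ²u≈0 : ∀ n → Δ (Δ (act (linPow a j) t)) n ≈ 0#
      Δ²u≈0 n = trans (act-cong (- a ∷ 1# ∷ []) (λ i → sym (act-linPow-suc j t i)) n)
                      (trans (sym (act-linPow-suc (suc j) t n)) (annihilated n))

module FiniteSubfieldProperties {c ℓ} (K : CommutativeRing c ℓ) {q}
                                (F : FieldNotions.FiniteSubfield K q) where
  open CommutativeRing K
  open FieldNotions K
  open FiniteSubfield F

  InF-≟ : ∀ {x y} → InF x → InF y → Dec (x ≈ y)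
  InF-≟ (i , x≈xᵢ) (j , y≈xⱼ) with i Fin.≟ j
  ... | yes ≡.refl = yes (trans x≈xᵢ (sym y≈xⱼ))
  ... | no i≢j     = no (λ x≈y → i≢j (inj i j (trans (sym x≈xᵢ) (trans x≈y y≈xⱼ))))

  pow-InF : ∀ {x} → InF x → ∀ n → InF (pow x n)
  pow-InF x∈F zero    = one∈
  pow-InF x∈F (suc n) = mul∈ _ _ x∈F (pow-InF x∈F n)

module CyclicPresentation {c ℓ} (K : CommutativeRing c ℓ) (isField : IsField K) where
  open CommutativeRing K
  open FieldNotions K
  open IsField isField
  open FieldProperties K isField
  open PowerProperties K
  open ShiftOperator K using (geometric)
  open import Relation.Binary.Reasoning.Setoid setoid

  module _ {m} {M : Carrier → Set m} {N} (G : IsFiniteSubgroup M N) {a} {s : ℤ → Carrier}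
           (step : ∀ n → s (n ℤ.+ + 1) ≈ a * s n) (presents : Presents M N s) where
    open IsFiniteSubgroup G

    private
      s₀ = s (+ 0)

      N≥1 : 1 ≤ N
      N≥1 = proj₁ (proj₁ presents)

      period : HasPeriod s N
      period = proj₁ (proj₂ (proj₁ presents))

      value∈M : ∀ i → i < N → M (s (+ i))
      value∈M i i<N = Equivalence.from (proj₂ presents (s (+ i))) (i , i<N , refl)

      s₀∈M : M s₀
      s₀∈M = value∈M 0 N≥1

      s₁∈M : M (s (+ 1))
      s₁∈M with ℕP.m≤n⇒m<n∨m≡n N≥1
      ... | inj₁ 1<N = value∈M 1 1<N
      ... | inj₂ 1≡N = respects _ _ (sym (≡.subst (HasPeriod s) (≡.sym 1≡N) period (+ 0))) s₀∈M

      values-geometric : ∀ i → s (+ i) ≈ pow a i * s₀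
      values-geometric = geometric step (+ 0)

      aᴺ≈1 : pow a N ≈ 1#
      aᴺ≈1 = *-cancelʳ-nonzero (nonzero s₀ s₀∈M) (begin
        pow a N * s₀   ≈⟨ values-geometric N ⟨
        s (+ N)        ≈⟨ period (+ 0) ⟩
        s₀             ≈⟨ *-identityˡ s₀ ⟨
        1# * s₀        ∎)

      s₀∈⟨a⟩ : ∃ λ r → s₀ ≈ pow a r
      s₀∈⟨a⟩ with Equivalence.to (proj₂ presents 1#) one∈
      ... | j , j<N , 1≈sⱼ = N ℕ.∸ j , (begin
        s₀                                  ≈⟨ *-identityˡ s₀ ⟨
        1# * s₀                             ≈⟨ *-congʳ aᴺ≈1 ⟨
        pow a N * s₀                        ≡⟨ ≡.cong (λ i → pow a i * s₀) (ℕP.m∸n+n≡m (ℕP.<⇒≤ j<N)) ⟨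
        pow a (N ℕ.∸ j ℕ.+ j) * s₀          ≈⟨ *-congʳ (pow-+ a (N ℕ.∸ j) j) ⟩
        pow a (N ℕ.∸ j) * pow a j * s₀      ≈⟨ *-assoc _ _ _ ⟩
        pow a (N ℕ.∸ j) * (pow a j * s₀)    ≈⟨ *-congˡ (trans 1≈sⱼ (values-geometric j)) ⟨
        pow a (N ℕ.∸ j) * 1#                ≈⟨ *-identityʳ _ ⟩
        pow a (N ℕ.∸ j)                     ∎)

      a∈M : M a
      a∈M with inverse s₀ (nonzero s₀ s₀∈M)
      ... | s₀⁻¹ , s₀s₀⁻¹≈1 = respects _ _ a≈s₁s₀⁻¹ (mul∈ _ _ s₁∈M (inv∈ s₀ s₀⁻¹ s₀∈M s₀s₀⁻¹≈1))
        where
        a≈s₁s₀⁻¹ : s (+ 1) * s₀⁻¹ ≈ a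
        a≈s₁s₀⁻¹ = begin
          s (+ 1) * s₀⁻¹     ≈⟨ *-congʳ (step (+ 0)) ⟩
          a * s₀ * s₀⁻¹      ≈⟨ *-assoc a s₀ s₀⁻¹ ⟩
          a * (s₀ * s₀⁻¹)    ≈⟨ *-congˡ s₀s₀⁻¹≈1 ⟩
          a * 1#             ≈⟨ *-identityʳ a ⟩
          a                  ∎

      pow∈M : ∀ n → M (pow a n)
      pow∈M zero    = one∈
      pow∈M (suc n) = mul∈ _ _ a∈M (pow∈M n)

    M⇔Generated : ∀ x → M x ⇔ Generated a x
    M⇔Generated x = mk⇔ to from
      where
      to : M x → Generated a x
      to x∈M with Equivalence.to (proj₂ presents x) x∈M | s₀∈⟨a⟩
      ... | i , _ , x≈sᵢ | r , s₀≈aʳ = i ℕ.+ r , inj₁ (begin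
        x                 ≈⟨ x≈sᵢ ⟩
        s (+ i)           ≈⟨ values-geometric i ⟩
        pow a i * s₀      ≈⟨ *-congˡ s₀≈aʳ ⟩
        pow a i * pow a r ≈⟨ pow-+ a i r ⟨
        pow a (i ℕ.+ r)   ∎)
      from : Generated a x → M x
      from (n , inj₁ x≈aⁿ)   = respects _ _ (sym x≈aⁿ) (pow∈M n)
      from (n , inj₂ xaⁿ≈1) = inv∈ (pow a n) x (pow∈M n) (trans (*-comm _ _) xaⁿ≈1)

mainTheorem2 : ∀ {c ℓ m : Level} (K : CommutativeRing c ℓ) → IsField K →
    let open CommutativeRing K
        open FieldNotions K
    in (p e : ℕ) → Prime p → 1 ≤ e →
       (Fq : FiniteSubfield (p ^ e)) →
       (a : Carrier) → FiniteSubfield.InF Fq a → ¬ (a ≈ 0#) →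
       (k : ℕ) → 1 ≤ k →
       (M : Carrier → Set m) (N : ℕ) → IsFiniteSubgroup M N →
       (∃ λ (s : ℤ → Carrier) → IsFSeq k (linPow a k) s × Presents M N s) →
       (∀ x → M x ⇔ Generated a x)
       × (∀ (s : ℤ → Carrier) → IsFSeq k (linPow a k) s → Presents M N s → Cyclic s)
mainTheorem2 K isField p e _ _ Fq a a∈Fq _ zero    ()
mainTheorem2 K isField p e _ _ Fq a a∈Fq _ (suc j) _  M N G (s₀ , s₀-recurrence , s₀-presents) =
  M⇔Generated G (geometricStep s₀-recurrence s₀-presents) s₀-presents ,
  λ s recurrence presents → a , geometricStep recurrence presents
  where
  open CommutativeRing K
  open FieldNotions K
  open ShiftOperator K using (IsFSeq⇒annihilated)
  open PolynomialProperties K using (length-linPow; coeff-linPow)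
  open FiniteSubgroupOrder K isField using (order≉0)
  open FiniteSubfieldProperties K Fq using (InF-≟; pow-InF)
  open LinearRecurrence K isField using (Δ≈0⇒geometricStep; periodic-annihilated⇒Δ≈0)
  open CyclicPresentation K isField using (M⇔Generated)

  -- Equality in K need not be decidable, but aᴺ = 1 can be decided inside F_q;
  -- this is the only use of F_q.
  geometricStep : ∀ {s} → IsFSeq (suc j) (linPow a (suc j)) s → Presents M N s →
                  ∀ n → s (n ℤ.+ + 1) ≈ a * s n
  geometricStep {s} recurrence ((_ , period , _) , _) =
    Δ≈0⇒geometricStep a (periodic-annihilated⇒Δ≈0 a (order≉0 G)
      (InF-≟ (pow-InF a∈Fq N) (FiniteSubfield.one∈ Fq)) j period
      (IsFSeq⇒annihilated (linPow a (suc j)) s (length-linPow a (suc j)) (coeff-linPow a (suc j)) recurrence))
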